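{- Every proof of a formula $F$ in $\mathsf{PA}^\exists$ can be transformed into a proof of $F$ consisting of purely intuitionistic proofs $\mathcal D_1,\dots,\mathcal D_n$ of $F$ (possibly with open assumptions, and not using the excluded-middle rule), combined by repeated applications of the excluded-middle rule $\textsc{em}$ whose conclusions are all $F$.
   Context: The $\exists$-translation $F^\exists$ leaves atomic formulas, $\wedge,\vee,\to,\exists$ unchanged (recursively) and sets $(\forall xF)^\exists=\neg\exists x\,\neg F^\exists$, with $\neg A:=A\to\bot$. $\mathsf{PA}^\exists$ is the natural-deduction system for arithmetic whose axioms are the $\exists$-translations of the Peano axioms, with the intuitionistic rules for $\wedge,\vee,\to,\exists,\bot$, the translated induction rule $Ind^\exists$ (from $\Gamma\vdash A(0)$ and $\Gamma\vdash\neg\exists\alpha\,\neg(A(\alpha)\to A(\mathsf S\alpha))$ infer $\Gamma\vdash\neg\exists\alpha\,\neg A(\alpha)$), and the excluded-middle rule $\textsc{em}$: from $\Gamma,A\vdash C$ and $\Gamma,\neg A\vdash C$ (discharging $A$, $\neg A$) infer $\Gamma\vdash C$, for arbitrary $A$ and $C$. A proof is purely intuitionistic if it uses no instance of $\textsc{em}$. -}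

module Defs where

open import Data.Nat using (ℕ; zero; suc; _+_)
open import Data.Fin using (Fin; _↑ʳ_) renaming (zero to fz; suc to fs)
open import Data.Bool using (Bool; true; false)
open import Data.List using (List; []; _∷_; map)
open import Data.List.Membership.Propositional using (_∈_)

data Tm (n : ℕ) : Set where
  var : Fin n → Tm n
  𝟎   : Tm n
  S   : Tm n → Tm n
  _⊕_ : Tm n → Tm n → Tm n
  _⊗_ : Tm n → Tm n → Tm n

-- Full first-order formulas (with ∀), used to state the Peano axioms.
data Fm (n : ℕ) : Set where
  _≐_  : Tm n → Tm n → Fm n
  ⊥f   : Fm n
  _∧f_ : Fm n → Fm n → Fm n
  _∨f_ : Fm n → Fm n → Fm n
  _⇒f_ : Fm n → Fm n → Fm n
  ∃f   : Fm (suc n) → Fm n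
  ∀f   : Fm (suc n) → Fm n

data EFm (n : ℕ) : Set where
  _≐_ : Tm n → Tm n → EFm n
  ⊥'  : EFm n
  _∧'_ : EFm n → EFm n → EFm n
  _∨'_ : EFm n → EFm n → EFm n
  _⇒_  : EFm n → EFm n → EFm n
  ∃'   : EFm (suc n) → EFm n

infix  6 _≐_
infixr 5 _∧'_ _∧f_
infixr 4 _∨'_ _∨f_
infixr 3 _⇒_ _⇒f_

~_ : ∀ {n} → EFm n → EFm n
~ A = A ⇒ ⊥'

~f_ : ∀ {n} → Fm n → Fm n
~f A = A ⇒f ⊥f

_ᴱ : ∀ {n} → Fm n → EFm n
(t ≐ s) ᴱ   = t ≐ s
⊥f ᴱ        = ⊥'
(A ∧f B) ᴱ  = A ᴱ ∧' B ᴱ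
(A ∨f B) ᴱ  = A ᴱ ∨' B ᴱ
(A ⇒f B) ᴱ  = A ᴱ ⇒ B ᴱ
(∃f A) ᴱ    = ∃' (A ᴱ)
(∀f A) ᴱ    = ~ ∃' (~ (A ᴱ))

tsub : ∀ {n m} → (Fin n → Tm m) → Tm n → Tm m
tsub σ (var i) = σ i
tsub σ 𝟎       = 𝟎
tsub σ (S t)   = S (tsub σ t)
tsub σ (t ⊕ s) = tsub σ t ⊕ tsub σ s
tsub σ (t ⊗ s) = tsub σ t ⊗ tsub σ s

exts : ∀ {n m} → (Fin n → Tm m) → Fin (suc n) → Tm (suc m)
exts σ fz     = var fz
exts σ (fs i) = tsub (λ j → var (fs j)) (σ i)

fsub : ∀ {n m} → (Fin n → Tm m) → EFm n → EFm m
fsub σ (t ≐ s)  = tsub σ t ≐ tsub σ s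
fsub σ ⊥'       = ⊥'
fsub σ (A ∧' B) = fsub σ A ∧' fsub σ B
fsub σ (A ∨' B) = fsub σ A ∨' fsub σ B
fsub σ (A ⇒ B)  = fsub σ A ⇒ fsub σ B
fsub σ (∃' A)   = ∃' (fsub (exts σ) A)

wk : ∀ {n} → EFm n → EFm (suc n)
wk = fsub (λ i → var (fs i))

wkBy : ∀ {n} k → EFm n → EFm (k + n)
wkBy k = fsub (λ i → var (k ↑ʳ i))

wkClosed : ∀ {n} → EFm 0 → EFm n
wkClosed = fsub (λ ())

_[_] : ∀ {n} → EFm (suc n) → Tm n → EFm n
A [ t ] = fsub σ A
  where
  σ : Fin (suc _) → Tm _
  σ fz     = t
  σ (fs i) = var i

_[S0] : ∀ {n} → EFm (suc n) → EFm (suc n)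
A [S0] = fsub σ A
  where
  σ : Fin (suc _) → Tm (suc _)
  σ fz     = S (var fz)
  σ (fs i) = var (fs i)

private
  x₀ : ∀ {n} → Tm (suc n)
  x₀ = var fz
  x₁ : ∀ {n} → Tm (suc (suc n))
  x₁ = var (fs fz)
  x₂ : ∀ {n} → Tm (suc (suc (suc n)))
  x₂ = var (fs (fs fz))

data PeanoAxiom : Fm 0 → Set where
  eq-refl  : PeanoAxiom (∀f (x₀ ≐ x₀))
  eq-eucl  : PeanoAxiom (∀f (∀f (∀f (x₂ ≐ x₁ ⇒f x₂ ≐ x₀ ⇒f x₁ ≐ x₀))))
  eq-S     : PeanoAxiom (∀f (∀f (x₁ ≐ x₀ ⇒f S x₁ ≐ S x₀)))
  eq-⊕l    : PeanoAxiom (∀f (∀f (∀f (x₂ ≐ x₁ ⇒f (x₂ ⊕ x₀) ≐ (x₁ ⊕ x₀)))))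
  eq-⊕r    : PeanoAxiom (∀f (∀f (∀f (x₂ ≐ x₁ ⇒f (x₀ ⊕ x₂) ≐ (x₀ ⊕ x₁)))))
  eq-⊗l    : PeanoAxiom (∀f (∀f (∀f (x₂ ≐ x₁ ⇒f (x₂ ⊗ x₀) ≐ (x₁ ⊗ x₀)))))
  eq-⊗r    : PeanoAxiom (∀f (∀f (∀f (x₂ ≐ x₁ ⇒f (x₀ ⊗ x₂) ≐ (x₀ ⊗ x₁)))))
  S≠0      : PeanoAxiom (∀f (~f (S x₀ ≐ 𝟎)))
  S-inj    : PeanoAxiom (∀f (∀f (S x₁ ≐ S x₀ ⇒f x₁ ≐ x₀)))
  plus-0   : PeanoAxiom (∀f ((x₀ ⊕ 𝟎) ≐ x₀))
  plus-S   : PeanoAxiom (∀f (∀f ((x₁ ⊕ S x₀) ≐ S (x₁ ⊕ x₀))))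
  times-0  : PeanoAxiom (∀f ((x₀ ⊗ 𝟎) ≐ 𝟎))
  times-S  : PeanoAxiom (∀f (∀f ((x₁ ⊗ S x₀) ≐ ((x₁ ⊗ x₀) ⊕ x₁))))

-- Deriv e Γ A : a derivation of A from open assumptions Γ;
-- the excluded-middle rule em is only available when e = true,
-- so  Deriv false  are exactly the purely intuitionistic proofs.
-- ∃-elimination: the eigenvariable is the fresh de Bruijn variable 0,
-- which (by weakening of Γ and C) cannot occur in Γ or C.

data Deriv : Bool → {n : ℕ} → List (EFm n) → EFm n → Set where
  hyp  : ∀ {e n} {Γ : List (EFm n)} {A} → A ∈ Γ → Deriv e Γ A
  ax   : ∀ {e n} {Γ : List (EFm n)} {P} → PeanoAxiom P → Deriv e Γ (wkClosed (P ᴱ))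
  ∧I   : ∀ {e n} {Γ : List (EFm n)} {A B} → Deriv e Γ A → Deriv e Γ B → Deriv e Γ (A ∧' B)
  ∧E₁  : ∀ {e n} {Γ : List (EFm n)} {A B} → Deriv e Γ (A ∧' B) → Deriv e Γ A
  ∧E₂  : ∀ {e n} {Γ : List (EFm n)} {A B} → Deriv e Γ (A ∧' B) → Deriv e Γ B
  ∨I₁  : ∀ {e n} {Γ : List (EFm n)} {A B} → Deriv e Γ A → Deriv e Γ (A ∨' B)
  ∨I₂  : ∀ {e n} {Γ : List (EFm n)} {A B} → Deriv e Γ B → Deriv e Γ (A ∨' B)
  ∨E   : ∀ {e n} {Γ : List (EFm n)} {A B C} → Deriv e Γ (A ∨' B) →
         Deriv e (A ∷ Γ) C → Deriv e (B ∷ Γ) C → Deriv e Γ C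
  ⇒I   : ∀ {e n} {Γ : List (EFm n)} {A B} → Deriv e (A ∷ Γ) B → Deriv e Γ (A ⇒ B)
  ⇒E   : ∀ {e n} {Γ : List (EFm n)} {A B} → Deriv e Γ (A ⇒ B) → Deriv e Γ A → Deriv e Γ B
  ⊥E   : ∀ {e n} {Γ : List (EFm n)} {A} → Deriv e Γ ⊥' → Deriv e Γ A
  ∃I   : ∀ {e n} {Γ : List (EFm n)} {A : EFm (suc n)} (t : Tm n) →
         Deriv e Γ (A [ t ]) → Deriv e Γ (∃' A)
  ∃E   : ∀ {e n} {Γ : List (EFm n)} {A : EFm (suc n)} {C} → Deriv e Γ (∃' A) →
         Deriv e (A ∷ map wk Γ) (wk C) → Deriv e Γ C
  ind  : ∀ {e n} {Γ : List (EFm n)} {A : EFm (suc n)} →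
         Deriv e Γ (A [ 𝟎 ]) →
         Deriv e Γ (~ ∃' (~ (A ⇒ A [S0]))) →
         Deriv e Γ (~ ∃' (~ A))
  em   : ∀ {n} {Γ : List (EFm n)} (A : EFm n) {C} →
         Deriv true (A ∷ Γ) C → Deriv true (~ A ∷ Γ) C → Deriv true Γ C

data EMTree {n : ℕ} : List (EFm n) → EFm n → Set where
  leaf : ∀ {Γ F} → Deriv false Γ F → EMTree Γ F
  node : ∀ {Γ F} (A : EFm n) → EMTree (A ∷ Γ) F → EMTree (~ A ∷ Γ) F → EMTree Γ F

-- Replace every application of em by an open assumption A ∨ ¬A; the
-- resulting purely intuitionistic proof uses finitely many such assumptions,
-- and splitting on each of them with em yields the required tree.
-- The only obstacle is ∃-elimination: an assumption B ∨ ¬B of its minor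
-- premise may mention the eigenvariable, so it cannot be moved below the
-- rule.  It is traded for the eigenvariable-free ∃x(Φ∧B) ∨ ¬∃x(Φ∧B), since
-- ¬∃x(Φ∧B) together with ∃xΦ intuitionistically yields ∃x(Φ∧¬B).  Hence no
-- fresh variables are needed and the theorem holds with k = 0.

module Submission where

open import Defs
open import Data.Nat using (ℕ; suc)
open import Data.Fin using (Fin) renaming (zero to fz; suc to fs)
open import Data.Bool using (Bool; true; false)
open import Data.List using (List; []; _∷_; map; _++_)
open import Data.List.Properties using (map-id; map-cong)
open import Data.List.Relation.Unary.Any using (here; there)
open import Data.List.Membership.Propositional.Properties using (∈-++⁺ʳ)
open import Data.List.Relation.Binary.Subset.Propositional using (_⊆_)
open import Data.List.Relation.Binary.Subset.Propositional.Properties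
  using (⊆-trans; ⊆-reflexive-↭; map⁺; xs⊆x∷xs; ∷⁺ʳ; xs⊆xs++ys; xs⊆ys++xs; ++⁺ʳ; ++⁺ˡ)
open import Data.List.Relation.Binary.Permutation.Propositional.Properties
  using (shift; ++-comm)
open import Data.Product using (Σ; _,_; uncurry)
open import Relation.Binary.PropositionalEquality
  using (_≡_; refl; sym; trans; cong; cong₂; subst; subst₂)

private
  variable
    e : Bool
    n m k : ℕ
    Γ Δ : List (EFm n)
    A B C Φ Ψ X : EFm n

tsub-cong : {σ τ : Fin n → Tm m} → (∀ i → σ i ≡ τ i) → ∀ t → tsub σ t ≡ tsub τ t
tsub-cong h (var i) = h i
tsub-cong h 𝟎       = refl
tsub-cong h (S t)   = cong S (tsub-cong h t)
tsub-cong h (t ⊕ s) = cong₂ _⊕_ (tsub-cong h t) (tsub-cong h s)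
tsub-cong h (t ⊗ s) = cong₂ _⊗_ (tsub-cong h t) (tsub-cong h s)

exts-cong : {σ τ : Fin n → Tm m} → (∀ i → σ i ≡ τ i) → ∀ i → exts σ i ≡ exts τ i
exts-cong h fz     = refl
exts-cong h (fs i) = cong (tsub (λ j → var (fs j))) (h i)

fsub-cong : {σ τ : Fin n → Tm m} → (∀ i → σ i ≡ τ i) → ∀ A → fsub σ A ≡ fsub τ A
fsub-cong h (t ≐ s)  = cong₂ _≐_ (tsub-cong h t) (tsub-cong h s)
fsub-cong h ⊥'       = refl
fsub-cong h (A ∧' B) = cong₂ _∧'_ (fsub-cong h A) (fsub-cong h B)
fsub-cong h (A ∨' B) = cong₂ _∨'_ (fsub-cong h A) (fsub-cong h B)
fsub-cong h (A ⇒ B)  = cong₂ _⇒_ (fsub-cong h A) (fsub-cong h B)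
fsub-cong h (∃' A)   = cong ∃' (fsub-cong (exts-cong h) A)

tsub-∘ : (σ : Fin m → Tm k) (τ : Fin n → Tm m) →
         ∀ t → tsub σ (tsub τ t) ≡ tsub (λ i → tsub σ (τ i)) t
tsub-∘ σ τ (var i) = refl
tsub-∘ σ τ 𝟎       = refl
tsub-∘ σ τ (S t)   = cong S (tsub-∘ σ τ t)
tsub-∘ σ τ (t ⊕ s) = cong₂ _⊕_ (tsub-∘ σ τ t) (tsub-∘ σ τ s)
tsub-∘ σ τ (t ⊗ s) = cong₂ _⊗_ (tsub-∘ σ τ t) (tsub-∘ σ τ s)

exts-∘ : (σ : Fin m → Tm k) (τ : Fin n → Tm m) →
         ∀ i → tsub (exts σ) (exts τ i) ≡ exts (λ j → tsub σ (τ j)) i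
exts-∘ σ τ fz     = refl
exts-∘ σ τ (fs i) = trans (tsub-∘ (exts σ) (λ j → var (fs j)) (τ i))
                          (sym (tsub-∘ (λ j → var (fs j)) σ (τ i)))

fsub-∘ : (σ : Fin m → Tm k) (τ : Fin n → Tm m) →
         ∀ A → fsub σ (fsub τ A) ≡ fsub (λ i → tsub σ (τ i)) A
fsub-∘ σ τ (t ≐ s)  = cong₂ _≐_ (tsub-∘ σ τ t) (tsub-∘ σ τ s)
fsub-∘ σ τ ⊥'       = refl
fsub-∘ σ τ (A ∧' B) = cong₂ _∧'_ (fsub-∘ σ τ A) (fsub-∘ σ τ B)
fsub-∘ σ τ (A ∨' B) = cong₂ _∨'_ (fsub-∘ σ τ A) (fsub-∘ σ τ B)
fsub-∘ σ τ (A ⇒ B)  = cong₂ _⇒_ (fsub-∘ σ τ A) (fsub-∘ σ τ B)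
fsub-∘ σ τ (∃' A)   = cong ∃' (trans (fsub-∘ (exts σ) (exts τ) A) (fsub-cong (exts-∘ σ τ) A))

tsub-id : {σ : Fin n → Tm n} → (∀ i → σ i ≡ var i) → ∀ t → tsub σ t ≡ t
tsub-id h (var i) = h i
tsub-id h 𝟎       = refl
tsub-id h (S t)   = cong S (tsub-id h t)
tsub-id h (t ⊕ s) = cong₂ _⊕_ (tsub-id h t) (tsub-id h s)
tsub-id h (t ⊗ s) = cong₂ _⊗_ (tsub-id h t) (tsub-id h s)

exts-id : {σ : Fin n → Tm n} → (∀ i → σ i ≡ var i) → ∀ i → exts σ i ≡ var i
exts-id h fz     = refl
exts-id h (fs i) = cong (tsub (λ j → var (fs j))) (h i)

fsub-id : {σ : Fin n → Tm n} → (∀ i → σ i ≡ var i) → ∀ A → fsub σ A ≡ A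
fsub-id h (t ≐ s)  = cong₂ _≐_ (tsub-id h t) (tsub-id h s)
fsub-id h ⊥'       = refl
fsub-id h (A ∧' B) = cong₂ _∧'_ (fsub-id h A) (fsub-id h B)
fsub-id h (A ∨' B) = cong₂ _∨'_ (fsub-id h A) (fsub-id h B)
fsub-id h (A ⇒ B)  = cong₂ _⇒_ (fsub-id h A) (fsub-id h B)
fsub-id h (∃' A)   = cong ∃' (fsub-id (exts-id h) A)

wkBy-zero : (A : EFm n) → wkBy 0 A ≡ A
wkBy-zero = fsub-id (λ _ → refl)

wk-∃-body-[var0] : (A : EFm (suc n)) → (fsub (exts (λ i → var (fs i))) A) [ var fz ] ≡ A
wk-∃-body-[var0] A = trans (fsub-∘ _ _ A) (fsub-id var0-fixed A)
  where
  var0-fixed : ∀ i → _ ≡ var i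
  var0-fixed fz     = refl
  var0-fixed (fs i) = refl

weaken : Γ ⊆ Δ → Deriv e Γ A → Deriv e Δ A
weaken s (hyp x)      = hyp (s x)
weaken s (ax p)       = ax p
weaken s (∧I d₁ d₂)   = ∧I (weaken s d₁) (weaken s d₂)
weaken s (∧E₁ d)      = ∧E₁ (weaken s d)
weaken s (∧E₂ d)      = ∧E₂ (weaken s d)
weaken s (∨I₁ d)      = ∨I₁ (weaken s d)
weaken s (∨I₂ d)      = ∨I₂ (weaken s d)
weaken s (∨E d d₁ d₂) = ∨E (weaken s d) (weaken (∷⁺ʳ _ s) d₁) (weaken (∷⁺ʳ _ s) d₂)
weaken s (⇒I d)       = ⇒I (weaken (∷⁺ʳ _ s) d)
weaken s (⇒E d₁ d₂)   = ⇒E (weaken s d₁) (weaken s d₂)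
weaken s (⊥E d)       = ⊥E (weaken s d)
weaken s (∃I t d)     = ∃I t (weaken s d)
weaken s (∃E d₁ d₂)   = ∃E (weaken s d₁) (weaken (∷⁺ʳ _ (map⁺ wk s)) d₂)
weaken s (ind d₁ d₂)  = ind (weaken s d₁) (weaken s d₂)
weaken s (em A d₁ d₂) = em A (weaken (∷⁺ʳ _ s) d₁) (weaken (∷⁺ʳ _ s) d₂)

cut : Deriv e Γ A → Deriv e (A ∷ Γ) C → Deriv e Γ C
cut d₁ d₂ = ⇒E (⇒I d₂) d₁

absorb : Deriv e (Ψ ∷ []) Φ → Deriv e (Ψ ∷ []) X → Deriv e (Φ ∷ X ∷ Δ) C → Deriv e (Ψ ∷ Δ) C
absorb {Ψ = Ψ} {Δ = Δ} dΦ dX d =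
  ⇒E (⇒E (weaken (xs⊆x∷xs Δ Ψ) (⇒I (⇒I d))) (weaken (xs⊆xs++ys _ Δ) dX))
     (weaken (xs⊆xs++ys _ Δ) dΦ)

∃I-fresh : Deriv e Γ A → Deriv e Γ (wk (∃' A))
∃I-fresh {e = e} {Γ = Γ} {A = A} d = ∃I (var fz) (subst (Deriv e Γ) (sym (wk-∃-body-[var0] A)) d)

¬∃∧⇒∃∧¬ : Deriv e (~ ∃' (Φ ∧' B) ∷ ∃' Φ ∷ Γ) (∃' (Φ ∧' ~ B))
¬∃∧⇒∃∧¬ = ∃E (hyp (there (here refl)))
  (∃I-fresh (∧I (hyp (here refl))
                (⇒I (⇒E (hyp (there (there (here refl))))
                        (∃I-fresh (∧I (hyp (there (here refl))) (hyp (here refl))))))))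

lem : EFm n → EFm n
lem A = A ∨' ~ A

lems : List (EFm n) → List (EFm n)
lems = map lem

_⊢lem_ : List (EFm n) → EFm n → Set
_⊢lem_ {n} Γ F = Σ (List (EFm n)) λ E → Deriv false (Γ ++ lems E) F

infix 2 _⊢lem_

lems-mono : ∀ {E E′} → E ⊆ E′ → Deriv e (Γ ++ lems E) A → Deriv e (Γ ++ lems E′) A
lems-mono {Γ = Γ} s = weaken (++⁺ʳ Γ (map⁺ lem s))

⊢lem-intro : Deriv false Γ A → Γ ⊢lem A
⊢lem-intro {Γ = Γ} d = [] , weaken (xs⊆xs++ys Γ []) d

⊢lem-map : {Γ₁ : List (EFm n)} {A₁ : EFm n} →
  (∀ {E} → Deriv false (Γ₁ ++ lems E) A₁ → Deriv false (Γ ++ lems E) A) →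
  Γ₁ ⊢lem A₁ → Γ ⊢lem A
⊢lem-map f (E , d) = E , f d

⊢lem-zipWith : {Γ₁ Γ₂ : List (EFm n)} {A₁ A₂ : EFm n} →
  (∀ {E} → Deriv false (Γ₁ ++ lems E) A₁ → Deriv false (Γ₂ ++ lems E) A₂ →
           Deriv false (Γ ++ lems E) A) →
  Γ₁ ⊢lem A₁ → Γ₂ ⊢lem A₂ → Γ ⊢lem A
⊢lem-zipWith f (E₁ , d₁) (E₂ , d₂) =
  E₁ ++ E₂ , f (lems-mono (xs⊆xs++ys E₁ E₂) d₁) (lems-mono (xs⊆ys++xs E₂ E₁) d₂)

⊢lem-zipWith₃ : {Γ₁ Γ₂ Γ₃ : List (EFm n)} {A₁ A₂ A₃ : EFm n} →
  (∀ {E} → Deriv false (Γ₁ ++ lems E) A₁ → Deriv false (Γ₂ ++ lems E) A₂ →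
           Deriv false (Γ₃ ++ lems E) A₃ → Deriv false (Γ ++ lems E) A) →
  Γ₁ ⊢lem A₁ → Γ₂ ⊢lem A₂ → Γ₃ ⊢lem A₃ → Γ ⊢lem A
⊢lem-zipWith₃ f (E₁ , d₁) (E₂ , d₂) (E₃ , d₃) =
  E₁ ++ E₂ ++ E₃ ,
  f (lems-mono (xs⊆xs++ys E₁ _) d₁)
    (lems-mono (⊆-trans (xs⊆xs++ys E₂ E₃) (xs⊆ys++xs _ E₁)) d₂)
    (lems-mono (⊆-trans (xs⊆ys++xs E₃ E₂) (xs⊆ys++xs _ E₁)) d₃)

⊢lem-replace : Deriv false Δ A → Γ ⊆ Δ → A ∷ Γ ⊢lem C → Δ ⊢lem C
⊢lem-replace {Δ = Δ} dA s (E , d) =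
  E , cut (weaken (xs⊆xs++ys Δ _) dA) (weaken (∷⁺ʳ _ (++⁺ˡ (lems E) s)) d)

⊢lem-split : (A : EFm n) → A ∷ Γ ⊢lem C → ~ A ∷ Γ ⊢lem C → Γ ⊢lem C
⊢lem-split {Γ = Γ} A (E₁ , d₁) (E₂ , d₂) =
  A ∷ E₁ ++ E₂ ,
  ∨E (hyp (∈-++⁺ʳ Γ (here refl)))
     (lems-mono (⊆-trans (xs⊆xs++ys E₁ E₂) (xs⊆x∷xs _ A)) d₁)
     (lems-mono (⊆-trans (xs⊆ys++xs E₂ E₁) (xs⊆x∷xs _ A)) d₂)

∃E-lems : ∀ Bs → Deriv false (Φ ∷ lems Bs ++ map wk Γ) (wk C) → ∃' Φ ∷ Γ ⊢lem C
∃E-lems [] d = ⊢lem-intro (∃E (hyp (here refl)) (weaken (∷⁺ʳ _ (xs⊆x∷xs _ _)) d))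
∃E-lems {Φ = Φ} (B ∷ Bs) d =
  ⊢lem-split (∃' (Φ ∧' B))
    (⊢lem-replace (hyp (here refl)) (xs⊆ys++xs _ (_ ∷ _ ∷ []))
      (∃E-lems Bs (absorb (∧E₁ (hyp (here refl))) (∨I₁ (∧E₂ (hyp (here refl)))) d)))
    (⊢lem-replace ¬∃∧⇒∃∧¬ (xs⊆ys++xs _ (_ ∷ _ ∷ []))
      (∃E-lems Bs (absorb (∧E₁ (hyp (here refl))) (∨I₂ (∧E₂ (hyp (here refl)))) d)))

⊢lem-∃E : Φ ∷ map wk Γ ⊢lem wk C → ∃' Φ ∷ Γ ⊢lem C
⊢lem-∃E {Γ = Γ} (E , d) = ∃E-lems E (weaken (∷⁺ʳ _ (⊆-reflexive-↭ (++-comm (map wk Γ) (lems E)))) d)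

em⇒⊢lem : Deriv true Γ A → Γ ⊢lem A
em⇒⊢lem (hyp x)      = ⊢lem-intro (hyp x)
em⇒⊢lem (ax p)       = ⊢lem-intro (ax p)
em⇒⊢lem (∧I d₁ d₂)   = ⊢lem-zipWith ∧I (em⇒⊢lem d₁) (em⇒⊢lem d₂)
em⇒⊢lem (∧E₁ d)      = ⊢lem-map ∧E₁ (em⇒⊢lem d)
em⇒⊢lem (∧E₂ d)      = ⊢lem-map ∧E₂ (em⇒⊢lem d)
em⇒⊢lem (∨I₁ d)      = ⊢lem-map ∨I₁ (em⇒⊢lem d)
em⇒⊢lem (∨I₂ d)      = ⊢lem-map ∨I₂ (em⇒⊢lem d)
em⇒⊢lem (∨E d d₁ d₂) = ⊢lem-zipWith₃ ∨E (em⇒⊢lem d) (em⇒⊢lem d₁) (em⇒⊢lem d₂)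
em⇒⊢lem (⇒I d)       = ⊢lem-map ⇒I (em⇒⊢lem d)
em⇒⊢lem (⇒E d₁ d₂)   = ⊢lem-zipWith ⇒E (em⇒⊢lem d₁) (em⇒⊢lem d₂)
em⇒⊢lem (⊥E d)       = ⊢lem-map ⊥E (em⇒⊢lem d)
em⇒⊢lem (∃I t d)     = ⊢lem-map (∃I t) (em⇒⊢lem d)
em⇒⊢lem (∃E d₁ d₂)   = ⊢lem-zipWith cut (em⇒⊢lem d₁) (⊢lem-∃E (em⇒⊢lem d₂))
em⇒⊢lem (ind d₁ d₂)  = ⊢lem-zipWith ind (em⇒⊢lem d₁) (em⇒⊢lem d₂)
em⇒⊢lem (em A d₁ d₂) = ⊢lem-split A (em⇒⊢lem d₁) (em⇒⊢lem d₂)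

lems⇒EMTree : ∀ E → Deriv false (Γ ++ lems E) A → EMTree Γ A
lems⇒EMTree []      d = leaf (weaken (⊆-reflexive-↭ (++-comm _ [])) d)
lems⇒EMTree {Γ = Γ} {A = A} (B ∷ E) d =
  node B (lems⇒EMTree E (cut (∨I₁ (hyp (here refl))) d′))
         (lems⇒EMTree E (cut (∨I₂ (hyp (here refl))) d′))
  where
  d′ : ∀ {B′} → Deriv false (lem B ∷ B′ ∷ Γ ++ lems E) A
  d′ = weaken (⊆-trans (⊆-reflexive-↭ (shift (lem B) Γ (lems E))) (∷⁺ʳ _ (xs⊆x∷xs _ _))) d

mainTheorem10 : ∀ {n} {Γ : List (EFm n)} {F : EFm n} →
    Deriv true Γ F →
    Σ ℕ (λ k → EMTree (map (wkBy k) Γ) (wkBy k F))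
mainTheorem10 {Γ = Γ} {F} d =
  0 , subst₂ EMTree (sym (trans (map-cong wkBy-zero Γ) (map-id Γ))) (sym (wkBy-zero F))
                    (uncurry lems⇒EMTree (em⇒⊢lem d))
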